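{- Let $l, s, m_1, \dots, m_s, r_1, \dots, r_s, r_{s+1}$ be positive integers with $r_1 \mid r_2,\ r_2 \mid r_3,\ \dots,\ r_s \mid r_{s+1}$. Define \[ \mathcal{A} = \{ r_1 j_1 + m_1 r_2 j_2 + \cdots + m_1 m_2 \cdots m_{s-1} r_s j_s + m_1 m_2 \cdots m_s r_{s+1} j_{s+1} : 0 \le j_{s+1} \le l-1,\ 0 \le j_i \le m_i - 1 \ (i = 1, \dots, s) \} \] and \[ \mathcal{B} = (r_1\mathbb{N} \setminus m_1 r_1 \mathbb{N}) \cup (m_1 r_2 \mathbb{N} \setminus m_1 m_2 r_2 \mathbb{N}) \cup \cdots \cup (m_1 \cdots m_{s-1} r_s \mathbb{N} \setminus m_1 \cdots m_s r_s \mathbb{N}) \cup (m_1 \cdots m_s r_{s+1} \mathbb{N} \setminus m_1 \cdots m_s r_{s+1} l \mathbb{N}). \] Then $P(\mathcal{A}; n) = Q(\mathcal{B}; n)$ for all $n \in \mathbb{N}$.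
   Context: $\mathbb{N} = \{1, 2, 3, \dots\}$. For $a \in \mathbb{N}$, $a\mathbb{N} = \{an : n \in \mathbb{N}\}$, and $X \setminus Y$ is set difference. A partition of $n$ is a finite non-increasing sequence of positive integers (parts) summing to $n$; the multiplicity of a part is the number of times it occurs. For $\mathcal{A} \subseteq \mathbb{N} \cup \{0\}$, $P(\mathcal{A}; n)$ denotes the number of partitions of $n$ in which the multiplicity of every part (that occurs) belongs to $\mathcal{A}$. For $\mathcal{B} \subseteq \mathbb{N}$, $Q(\mathcal{B}; n)$ denotes the number of partitions of $n$ all of whose parts belong to $\mathcal{B}$. By convention $P(\mathcal{A}; 0) = Q(\mathcal{B}; 0) = 1$. -}

module Defs where

open import Data.Nat using (ℕ; zero; suc; _+_; _*_; _∸_; _⊓_; _<_; _≤_)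
open import Data.Nat.Properties using (_≟_)
open import Data.Nat.Divisibility using (_∣_; _∣?_)
open import Data.Fin using (Fin; zero; suc)
open import Data.Fin.Properties using (any?)
open import Data.List using (List; []; _∷_; [_]; map; concatMap; applyUpTo; upTo; filter; length)
open import Data.List.Relation.Unary.All using (All) renaming (all? to listAll?)
open import Data.List.Membership.Propositional using (_∈_)
open import Data.List.Membership.DecPropositional _≟_ using (_∈?_)
open import Data.Product using (Σ; _×_; _,_)
open import Relation.Nullary using (¬_; Dec)
open import Relation.Nullary.Decidable using (_×-dec_; ¬?)
open import Relation.Unary using (Pred; Decidable)
open import Function using (_∘_)
import Level

-- A partition of n is a non-increasing list of positive integers summing
-- to n.  partsF fuel n k lists all non-increasing lists of positive
-- integers summing to n with every part ≤ k (fuel ≥ n suffices since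
-- every step removes a part ≥ 1).

partsF : ℕ → ℕ → ℕ → List (List ℕ)
partsF _        zero    k = [ [] ]
partsF zero     (suc n) k = []
partsF (suc f)  (suc n) k =
  concatMap (λ p → map (p ∷_) (partsF f (suc n ∸ p) p))
            (applyUpTo suc (suc n ⊓ k))

partitions : ℕ → List (List ℕ)
partitions n = partsF n n n

mult : ℕ → List ℕ → ℕ
mult p xs = length (filter (p ≟_) xs)

P : ∀ {ℓ} (𝒜 : Pred ℕ ℓ) → Decidable 𝒜 → ℕ → ℕ
P 𝒜 𝒜? n = length (filter (λ xs → listAll? (λ p → 𝒜? (mult p xs)) xs) (partitions n))

Q : ∀ {ℓ} (ℬ : Pred ℕ ℓ) → Decidable ℬ → ℕ → ℕ
Q ℬ ℬ? n = length (filter (listAll? ℬ?) (partitions n))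

-- Data of Theorem 3.1.  Indices are shifted to start at 0:
-- m i = m_{i+1} (i : Fin s),  r i = r_{i+1} (i : Fin (s+1)).

prefixProd : ∀ {s} → (Fin s → ℕ) → Fin (suc s) → ℕ
prefixProd m zero = 1
prefixProd {suc s} m (suc i) = m zero * prefixProd (m ∘ suc) i

snocF : ∀ {s} → (Fin s → ℕ) → ℕ → Fin (suc s) → ℕ
snocF {zero}  f x zero    = x
snocF {suc s} f x zero    = f zero
snocF {suc s} f x (suc i) = snocF (f ∘ suc) x i

coeff : ∀ {s} → (m : Fin s → ℕ) → (r : Fin (suc s) → ℕ) → Fin (suc s) → ℕ
coeff m r i = prefixProd m i * r i

tuples : ∀ t → (Fin t → ℕ) → List (Fin t → ℕ)
tuples zero    b = [ (λ ()) ]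
tuples (suc t) b =
  concatMap (λ v → map (λ f → λ { zero → v ; (suc i) → f i }) (tuples t (b ∘ suc)))
            (upTo (b zero))

sumF : ∀ {t} → (Fin t → ℕ) → ℕ
sumF {zero}  f = 0
sumF {suc t} f = f zero + sumF (f ∘ suc)

𝒜list : (l s : ℕ) → (m : Fin s → ℕ) → (r : Fin (suc s) → ℕ) → List ℕ
𝒜list l s m r =
  map (λ j → sumF (λ i → coeff m r i * j i)) (tuples (suc s) (snocF m l))

𝒜 : (l s : ℕ) → (m : Fin s → ℕ) → (r : Fin (suc s) → ℕ) → Pred ℕ Level.zero
𝒜 l s m r x = x ∈ 𝒜list l s m r

𝒜? : (l s : ℕ) → (m : Fin s → ℕ) → (r : Fin (suc s) → ℕ) → Decidable (𝒜 l s m r)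
𝒜? l s m r x = x ∈? 𝒜list l s m r

-- ℬ = ⋃_i ( c_i ℕ \ c_i e_i ℕ ),  c_i = m_1⋯m_{i-1} r_i,  e = (m_1,…,m_s,l);
-- ℕ = {1,2,…}, so members are positive.
ℬ : (l s : ℕ) → (m : Fin s → ℕ) → (r : Fin (suc s) → ℕ) → Pred ℕ Level.zero
ℬ l s m r x = 1 ≤ x × Σ (Fin (suc s)) (λ i → (coeff m r i ∣ x) × ¬ (coeff m r i * snocF m l i ∣ x))

ℬ? : (l s : ℕ) → (m : Fin s → ℕ) → (r : Fin (suc s) → ℕ) → Decidable (ℬ l s m r)
ℬ? l s m r x = (1 Data.Nat.≤? x) ×-dec any? (λ i → (coeff m r i ∣? x) ×-dec ¬? (coeff m r i * snocF m l i ∣? x))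

module Submission where

-- Both sides are coefficients of products of power series in z.  P(𝒜; n) is the
-- coefficient of zⁿ in ∏ₚ Σ_{μ ∈ 𝒜 ∪ {0}} z^{pμ}, and Q(ℬ; n) that of ∏_{b ∈ ℬ} 1/(1 − z^b);
-- truncating the products to p ≤ N keeps the coefficients up to z^N.  Every μ ∈ 𝒜 is uniquely
-- r₁ j + m₁ a with j < m₁ and a in the set 𝒜′ of the data (m₂, …, m_s; r₂, …, r_{s+1}),
-- since r₁ divides every element of 𝒜′.  Hence the factor of p splits as
-- (1 − z^{p r₁ m₁})/(1 − z^{p r₁}) times the factor of 𝒜′ at z^{p m₁}.  By Euler's argument
-- ∏ₚ (1 − z^{pce})/(1 − z^{pc}) = ∏ 1/(1 − z^b) over b ∈ cℕ ∖ ceℕ, which gives the first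
-- set of ℬ, and induction on s, with all parts scaled by m₁, gives the others.

open import Defs

open import Data.Fin using (Fin; zero; suc; inject₁)
open import Data.Fin.Properties using (any?)
open import Data.List using (List; []; _∷_; [_]; map; concatMap; applyUpTo; upTo; filter; length; replicate; _++_)
open import Data.List.Properties using (length-++; filter-++; concatMap-++; applyUpTo-∷ʳ; ++-identityʳ)
open import Data.List.Membership.Propositional using (_∈_; lose; find)
open import Data.List.Membership.Propositional.Properties
  using (∈-map⁺; ∈-map⁻; ∈-concatMap⁺; ∈-concatMap⁻; ∈-upTo⁺; ∈-upTo⁻)
open import Data.List.Relation.Unary.All as All using (All; []; _∷_)
open import Data.List.Relation.Unary.All.Properties using (++⁺; ++⁻; concat⁺; map⁺; applyUpTo⁺₁; replicate⁺)
open import Data.List.Relation.Unary.Any using (here)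
open import Data.Nat
open import Data.Nat.Divisibility
open import Data.Nat.DivMod using (_%_; _/_; m%n<n; m≡m%n+[m/n]*n; %-congˡ; [m+kn]%n≡m%n; m<n⇒m%n≡m)
open import Data.Nat.Properties
open import Data.Nat.Tactic.RingSolver using (solve-∀)
open import Data.Product using (_×_; _,_; proj₁; ∃)
open import Data.Sum using (_⊎_; inj₁; inj₂)
import Data.Sum as Sum
open import Data.Unit using (⊤; tt)
open import Function using (_∘_; id; _⇔_; mk⇔; Equivalence)
open import Level using (0ℓ)
open import Relation.Binary.Bundles using (Setoid)
open import Relation.Binary.PropositionalEquality hiding ([_])
open import Relation.Nullary using (Dec; yes; no; ¬_; contradiction)
open import Relation.Nullary.Decidable using (¬?; _×-dec_; _⊎-dec_; decidable-stable)
open import Relation.Unary using (Pred; Decidable)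

open Setoid (ℕ →-setoid ℕ) using () renaming (sym to ≗-sym; trans to ≗-trans)

-- Formal power series over ℕ

Series : Set
Series = ℕ → ℕ

infix  4 _≈[_]_
infixl 6 _⊕_
infixl 7 _⊛_
infixr 8 _⊙_

0ₛ 1ₛ : Series
0ₛ _ = 0
1ₛ zero = 1
1ₛ (suc t) = 0

1ₛ-positive : ∀ {t} → 1 ≤ t → 1ₛ t ≡ 0
1ₛ-positive {suc t} _ = refl

_⊕_ : Series → Series → Series
(f ⊕ g) t = f t + g t

_⊙_ : ℕ → Series → Series
(a ⊙ f) t = a * f t

_⊛_ : Series → Series → Series
(f ⊛ g) zero = f 0 * g 0
(f ⊛ g) (suc t) = f 0 * g (suc t) + ((f ∘ suc) ⊛ g) t

_≈[_]_ : Series → ℕ → Series → Set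
f ≈[ N ] g = ∀ t → t ≤ N → f t ≡ g t

≈-sym : ∀ {N f g} → f ≈[ N ] g → g ≈[ N ] f
≈-sym e t t≤N = sym (e t t≤N)

≈-trans : ∀ {N f g h} → f ≈[ N ] g → g ≈[ N ] h → f ≈[ N ] h
≈-trans e e′ t t≤N = trans (e t t≤N) (e′ t t≤N)

≗⇒≈ : ∀ {N f g} → f ≗ g → f ≈[ N ] g
≗⇒≈ e t _ = e t

⊛-congˡ : ∀ {f f′} g → f ≗ f′ → f ⊛ g ≗ f′ ⊛ g
⊛-congˡ g e zero = cong (_* g 0) (e 0)
⊛-congˡ g e (suc t) = cong₂ _+_ (cong (_* g (suc t)) (e 0)) (⊛-congˡ g (e ∘ suc) t)

⊛-congʳ : ∀ f {g g′} → g ≗ g′ → f ⊛ g ≗ f ⊛ g′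
⊛-congʳ f e zero = cong (f 0 *_) (e 0)
⊛-congʳ f e (suc t) = cong₂ _+_ (cong (f 0 *_) (e (suc t))) (⊛-congʳ (f ∘ suc) e t)

⊛-cong : ∀ {f f′ g g′} → f ≗ f′ → g ≗ g′ → f ⊛ g ≗ f′ ⊛ g′
⊛-cong {f′ = f′} {g = g} e e′ t = trans (⊛-congˡ g e t) (⊛-congʳ f′ e′ t)

⊛-≈ʳ : ∀ {N} f {g g′} → g ≈[ N ] g′ → f ⊛ g ≈[ N ] f ⊛ g′
⊛-≈ʳ f e zero t≤N = cong (f 0 *_) (e 0 t≤N)
⊛-≈ʳ f e (suc t) t≤N =
  cong₂ _+_ (cong (f 0 *_) (e (suc t) t≤N)) (⊛-≈ʳ (f ∘ suc) e t (≤-trans (n≤1+n t) t≤N))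

⊛-zeroˡ : ∀ g → 0ₛ ⊛ g ≗ 0ₛ
⊛-zeroˡ g zero = refl
⊛-zeroˡ g (suc t) = ⊛-zeroˡ g t

⊛-identityˡ : ∀ g → 1ₛ ⊛ g ≗ g
⊛-identityˡ g zero = +-identityʳ (g 0)
⊛-identityˡ g (suc t) = trans (cong₂ _+_ (+-identityʳ (g (suc t))) (⊛-zeroˡ g t)) (+-identityʳ _)

⊛-identityʳ : ∀ f → f ⊛ 1ₛ ≗ f
⊛-identityʳ f zero = *-identityʳ (f 0)
⊛-identityʳ f (suc t) = trans (cong (_+ ((f ∘ suc) ⊛ 1ₛ) t) (*-zeroʳ (f 0))) (⊛-identityʳ (f ∘ suc) t)

⊛-suc : ∀ f g t → (f ⊛ g) (suc t) ≡ (f ⊛ (g ∘ suc)) t + f (suc t) * g 0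
⊛-suc f g zero = refl
⊛-suc f g (suc t) =
  trans (cong (f 0 * g (suc (suc t)) +_) (⊛-suc (f ∘ suc) g t))
        (sym (+-assoc (f 0 * g (suc (suc t))) _ _))

⊛-comm : ∀ f g → f ⊛ g ≗ g ⊛ f
⊛-comm f g zero = *-comm (f 0) (g 0)
⊛-comm f g (suc t) = begin
  f 0 * g (suc t) + ((f ∘ suc) ⊛ g) t  ≡⟨ cong (f 0 * g (suc t) +_) (⊛-comm (f ∘ suc) g t) ⟩
  f 0 * g (suc t) + (g ⊛ (f ∘ suc)) t  ≡⟨ +-comm (f 0 * g (suc t)) _ ⟩
  (g ⊛ (f ∘ suc)) t + f 0 * g (suc t)  ≡⟨ cong ((g ⊛ (f ∘ suc)) t +_) (*-comm (f 0) (g (suc t))) ⟩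
  (g ⊛ (f ∘ suc)) t + g (suc t) * f 0  ≡⟨ ⊛-suc g f t ⟨
  (g ⊛ f) (suc t)                      ∎
  where open ≡-Reasoning

⊛-≈ˡ : ∀ {N f f′} g → f ≈[ N ] f′ → f ⊛ g ≈[ N ] f′ ⊛ g
⊛-≈ˡ {f = f} {f′} g e t t≤N = trans (⊛-comm f g t) (trans (⊛-≈ʳ g e t t≤N) (⊛-comm g f′ t))

⊛-≈ : ∀ {N f f′ g g′} → f ≈[ N ] f′ → g ≈[ N ] g′ → f ⊛ g ≈[ N ] f′ ⊛ g′
⊛-≈ {f′ = f′} {g = g} e e′ t t≤N = trans (⊛-≈ˡ g e t t≤N) (⊛-≈ʳ f′ e′ t t≤N)

⊛-distribʳ-⊕ : ∀ f g h → (f ⊕ g) ⊛ h ≗ f ⊛ h ⊕ g ⊛ h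
⊛-distribʳ-⊕ f g h zero = *-distribʳ-+ (h 0) (f 0) (g 0)
⊛-distribʳ-⊕ f g h (suc t) =
  trans (cong₂ _+_ (*-distribʳ-+ (h (suc t)) (f 0) (g 0)) (⊛-distribʳ-⊕ (f ∘ suc) (g ∘ suc) h t))
        (interchange (f 0 * h (suc t)) (g 0 * h (suc t)) _ _)
  where interchange : ∀ a b c d → a + b + (c + d) ≡ (a + c) + (b + d)
        interchange = solve-∀

⊛-distribˡ-⊕ : ∀ f g h → f ⊛ (g ⊕ h) ≗ f ⊛ g ⊕ f ⊛ h
⊛-distribˡ-⊕ f g h t =
  trans (⊛-comm f (g ⊕ h) t)
        (trans (⊛-distribʳ-⊕ g h f t) (cong₂ _+_ (⊛-comm g f t) (⊛-comm h f t)))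

⊙-⊛-assoc : ∀ a f h → (a ⊙ f) ⊛ h ≗ a ⊙ (f ⊛ h)
⊙-⊛-assoc a f h zero = *-assoc a (f 0) (h 0)
⊙-⊛-assoc a f h (suc t) =
  trans (cong₂ _+_ (*-assoc a (f 0) (h (suc t))) (⊙-⊛-assoc a (f ∘ suc) h t))
        (sym (*-distribˡ-+ a _ _))

⊛-⊙-comm : ∀ a f h → f ⊛ (a ⊙ h) ≗ a ⊙ (f ⊛ h)
⊛-⊙-comm a f h t =
  trans (⊛-comm f (a ⊙ h) t) (trans (⊙-⊛-assoc a h f t) (cong (a *_) (⊛-comm h f t)))

⊛-assoc : ∀ f g h → (f ⊛ g) ⊛ h ≗ f ⊛ (g ⊛ h)
⊛-assoc f g h zero = *-assoc (f 0) (g 0) (h 0)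
⊛-assoc f g h (suc t) = begin
  f 0 * g 0 * h (suc t) + (((f ⊛ g) ∘ suc) ⊛ h) t
    ≡⟨ cong (f 0 * g 0 * h (suc t) +_) (⊛-distribʳ-⊕ (f 0 ⊙ (g ∘ suc)) ((f ∘ suc) ⊛ g) h t) ⟩
  f 0 * g 0 * h (suc t) + (((f 0 ⊙ (g ∘ suc)) ⊛ h) t + (((f ∘ suc) ⊛ g) ⊛ h) t)
    ≡⟨ cong₂ (λ x y → f 0 * g 0 * h (suc t) + (x + y))
             (⊙-⊛-assoc (f 0) (g ∘ suc) h t) (⊛-assoc (f ∘ suc) g h t) ⟩
  f 0 * g 0 * h (suc t) + (f 0 * ((g ∘ suc) ⊛ h) t + ((f ∘ suc) ⊛ (g ⊛ h)) t)
    ≡⟨ regroup (f 0) (g 0) (h (suc t)) _ _ ⟩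
  f 0 * (g 0 * h (suc t) + ((g ∘ suc) ⊛ h) t) + ((f ∘ suc) ⊛ (g ⊛ h)) t
    ∎
  where
  open ≡-Reasoning
  regroup : ∀ a b c d e → a * b * c + (a * d + e) ≡ a * (b * c + d) + e
  regroup = solve-∀

⊛-interchange : ∀ a b c d → (a ⊛ b) ⊛ (c ⊛ d) ≗ (a ⊛ c) ⊛ (b ⊛ d)
⊛-interchange a b c d =
  ≗-trans (⊛-assoc a b (c ⊛ d))
  (≗-trans (⊛-congʳ a (≗-sym (⊛-assoc b c d)))
  (≗-trans (⊛-congʳ a (⊛-congˡ d (⊛-comm b c)))
  (≗-trans (⊛-congʳ a (⊛-assoc c b d))
  (≗-sym (⊛-assoc a c (b ⊛ d))))))

⊛-cancelʳ : ∀ {N} f g u → u 0 ≡ 1 → f ⊛ u ≈[ N ] g ⊛ u → f ≈[ N ] g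
⊛-cancelʳ {N} f g u u₀≡1 e = agreeUpTo N ≤-refl
  where
  atZero : ∀ h → (h ⊛ u) 0 ≡ h 0
  atZero h = trans (cong (h 0 *_) u₀≡1) (*-identityʳ (h 0))
  atSuc : ∀ h t → (h ⊛ u) (suc t) ≡ h (suc t) + ((u ∘ suc) ⊛ h) t
  atSuc h t = trans (⊛-comm h u (suc t))
    (cong (_+ ((u ∘ suc) ⊛ h) t) (trans (cong (_* h (suc t)) u₀≡1) (*-identityˡ (h (suc t)))))
  agreeUpTo : ∀ n → n ≤ N → f ≈[ n ] g
  agreeUpTo zero 0≤N zero _ = trans (sym (atZero f)) (trans (e 0 0≤N) (atZero g))
  agreeUpTo (suc n) n<N t t≤1+n with m≤n⇒m<n∨m≡n t≤1+n
  ... | inj₁ (s≤s t≤n) = agreeUpTo n (<⇒≤ n<N) t t≤n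
  ... | inj₂ refl = +-cancelʳ-≡ _ (f (suc n)) (g (suc n)) (begin
    f (suc n) + ((u ∘ suc) ⊛ f) n  ≡⟨ atSuc f n ⟨
    (f ⊛ u) (suc n)                ≡⟨ e (suc n) n<N ⟩
    (g ⊛ u) (suc n)                ≡⟨ atSuc g n ⟩
    g (suc n) + ((u ∘ suc) ⊛ g) n  ≡⟨ cong (g (suc n) +_) (⊛-≈ʳ (u ∘ suc) (agreeUpTo n (<⇒≤ n<N)) n ≤-refl) ⟨
    g (suc n) + ((u ∘ suc) ⊛ f) n  ∎)
    where open ≡-Reasoning

shift₁ : Series → Series
shift₁ f zero = 0
shift₁ f (suc t) = f t

shift : ℕ → Series → Series
shift zero f = f
shift (suc w) f = shift₁ (shift w f)

shift-cong : ∀ w {f g} → f ≗ g → shift w f ≗ shift w g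
shift-cong zero e = e
shift-cong (suc w) e zero = refl
shift-cong (suc w) e (suc t) = shift-cong w e t

shift-≥ : ∀ w f t → w ≤ t → shift w f t ≡ f (t ∸ w)
shift-≥ zero f t _ = refl
shift-≥ (suc w) f (suc t) (s≤s w≤t) = shift-≥ w f t w≤t

shift-< : ∀ w f t → t < w → shift w f t ≡ 0
shift-< (suc w) f zero _ = refl
shift-< (suc w) f (suc t) (s≤s t<w) = shift-< w f t t<w

⊛-shift₁ : ∀ f g → f ⊛ shift₁ g ≗ shift₁ (f ⊛ g)
⊛-shift₁ f g zero = *-zeroʳ (f 0)
⊛-shift₁ f g (suc zero) = trans (cong (f 0 * g 0 +_) (*-zeroʳ (f 1))) (+-identityʳ _)
⊛-shift₁ f g (suc (suc t)) = cong (f 0 * g (suc t) +_) (⊛-shift₁ (f ∘ suc) g (suc t))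

⊛-shift : ∀ w f g → f ⊛ shift w g ≗ shift w (f ⊛ g)
⊛-shift zero f g t = refl
⊛-shift (suc w) f g t = trans (⊛-shift₁ f (shift w g) t) (shift-cong 1 (⊛-shift w f g) t)

-- Indicators, products and dilations

χ : ∀ {a} {A : Set a} → Dec A → ℕ
χ (yes _) = 1
χ (no _) = 0

χ-yes : ∀ {a} {A : Set a} (a? : Dec A) → A → χ a? ≡ 1
χ-yes (yes _) _ = refl
χ-yes (no ¬a) a = contradiction a ¬a

χ-no : ∀ {a} {A : Set a} (a? : Dec A) → ¬ A → χ a? ≡ 0
χ-no (yes a) ¬a = contradiction a ¬a
χ-no (no _) _ = refl

χ-cong : ∀ {a b} {A : Set a} {B : Set b} → (A → B) → (B → A) → (a? : Dec A) (b? : Dec B) → χ a? ≡ χ b?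
χ-cong to from a? (yes b) = χ-yes a? (from b)
χ-cong to from a? (no ¬b) = χ-no a? (¬b ∘ to)

χ≢0⇒ : ∀ {a} {A : Set a} (a? : Dec A) → χ a? ≢ 0 → A
χ≢0⇒ (yes a) _ = a
χ≢0⇒ (no _) χ≢0 = contradiction refl χ≢0

when : ∀ {a} {A : Set a} → Dec A → Series → Series
when (yes _) f = f
when (no _) _ = 1ₛ

when-yes : ∀ {A : Set} (a? : Dec A) f → A → when a? f ≗ f
when-yes (yes _) f _ t = refl
when-yes (no ¬a) f a t = contradiction a ¬a

when-no : ∀ {A : Set} (a? : Dec A) f → ¬ A → when a? f ≗ 1ₛ
when-no (yes a) f ¬a t = contradiction a ¬a
when-no (no _) f _ t = refl

when-cong : ∀ {A B : Set} → (A → B) → (B → A) → (a? : Dec A) (b? : Dec B) → ∀ f → when a? f ≗ when b? f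
when-cong to from a? (yes b) f = when-yes a? f (from b)
when-cong to from a? (no ¬b) f = when-no a? f (¬b ∘ to)

when-¬⊛when : ∀ {A : Set} (a? : Dec A) f → when (¬? a?) f ⊛ when a? f ≗ f
when-¬⊛when (yes _) f = ⊛-identityˡ f
when-¬⊛when (no _) f = ⊛-identityʳ f

when-× : ∀ {A B : Set} (a? : Dec A) (b? : Dec B) f → when (a? ×-dec b?) f ≗ when a? (when b? f)
when-× (yes _) (yes _) f t = refl
when-× (yes _) (no _) f t = refl
when-× (no _) _ f t = refl

when-⊎ : ∀ {A B C : Set} (a? : Dec A) (b? : Dec B) (c? : Dec C) f →
  (C → A ⊎ B) → (A → C) → (B → C) → (A → ¬ B) → when a? f ⊛ when b? f ≗ when c? f
when-⊎ (yes a) (yes b) _ f _ _ _ a⇒¬b = contradiction b (a⇒¬b a)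
when-⊎ (yes a) (no _) c? f _ a⇒c _ _ = ≗-trans (⊛-identityʳ f) (≗-sym (when-yes c? f (a⇒c a)))
when-⊎ (no _) (yes b) c? f _ _ b⇒c _ = ≗-trans (⊛-identityˡ f) (≗-sym (when-yes c? f (b⇒c b)))
when-⊎ (no ¬a) (no ¬b) c? f c⇒a⊎b _ _ _ =
  ≗-trans (⊛-identityˡ 1ₛ) (≗-sym (when-no c? f (Sum.[ ¬a , ¬b ] ∘ c⇒a⊎b)))

∏ : (ℕ → Series) → ℕ → Series
∏ F zero = 1ₛ
∏ F (suc M) = ∏ F M ⊛ F (suc M)

∏-cong : ∀ {F G} M → (∀ p → 1 ≤ p → p ≤ M → F p ≗ G p) → ∏ F M ≗ ∏ G M
∏-cong zero e = λ _ → refl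
∏-cong (suc M) e =
  ⊛-cong (∏-cong M (λ p 1≤p p≤M → e p 1≤p (m≤n⇒m≤1+n p≤M))) (e (suc M) (s≤s z≤n) ≤-refl)

∏-⊛ : ∀ F G M → ∏ (λ p → F p ⊛ G p) M ≗ ∏ F M ⊛ ∏ G M
∏-⊛ F G zero t = sym (⊛-identityˡ 1ₛ t)
∏-⊛ F G (suc M) =
  ≗-trans (⊛-congˡ _ (∏-⊛ F G M)) (⊛-interchange (∏ F M) (∏ G M) (F (suc M)) (G (suc M)))

∏-constant : ∀ F M → (∀ p → 1 ≤ p → F p 0 ≡ 1) → ∏ F M 0 ≡ 1
∏-constant F zero _ = refl
∏-constant F (suc M) F₀≡1 = cong₂ _*_ (∏-constant F M F₀≡1) (F₀≡1 (suc M) (s≤s z≤n))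

∏-extend : ∀ {N} F M M′ → M ≤ M′ → (∀ p → M < p → p ≤ M′ → F p ≈[ N ] 1ₛ) → ∏ F M ≈[ N ] ∏ F M′
∏-extend F M zero z≤n _ = λ _ _ → refl
∏-extend F M (suc M′) M≤1+M′ trivial with m≤n⇒m<n∨m≡n M≤1+M′
... | inj₂ refl = λ _ _ → refl
... | inj₁ (s≤s M≤M′) = λ t t≤N →
  trans (∏-extend F M M′ M≤M′ (λ p M<p p≤M′ → trivial p M<p (m≤n⇒m≤1+n p≤M′)) t t≤N)
  (trans (sym (⊛-identityʳ (∏ F M′) t))
         (⊛-≈ʳ (∏ F M′) (≈-sym (trivial (suc M′) (s≤s M≤M′) ≤-refl)) t t≤N))

-- dilate w q is the series q(z^w).
dilate : ℕ → (ℕ → ℕ) → Series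
dilate w q t with w ∣? t
... | yes (divides μ _) = q μ
... | no _ = 0

dilate-cong : ∀ w {q q′} → (∀ μ → q μ ≡ q′ μ) → dilate w q ≗ dilate w q′
dilate-cong w e t with w ∣? t
... | yes (divides μ _) = e μ
... | no _ = refl

dilate-∣ : ∀ w q {t} μ → 1 ≤ w → t ≡ μ * w → dilate w q t ≡ q μ
dilate-∣ w q {t} μ 1≤w t≡μw with w ∣? t
... | no w∤t = contradiction (divides μ t≡μw) w∤t
... | yes (divides μ′ t≡μ′w) = cong q (*-cancelʳ-≡ μ′ μ w {{>-nonZero 1≤w}} (trans (sym t≡μ′w) t≡μw))

dilate-∤ : ∀ w q {t} → ¬ w ∣ t → dilate w q t ≡ 0
dilate-∤ w q {t} w∤t with w ∣? t
... | yes w∣t = contradiction w∣t w∤t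
... | no _ = refl

dilate-0 : ∀ w q → 1 ≤ w → dilate w q 0 ≡ q 0
dilate-0 w q 1≤w = dilate-∣ w q 0 1≤w refl

dilate-≢0 : ∀ w q t → dilate w q t ≢ 0 → ∃ λ μ → t ≡ μ * w × q μ ≢ 0
dilate-≢0 w q t ≢0 with w ∣? t
... | yes (divides μ t≡μw) = μ , t≡μw , ≢0
... | no _ = contradiction refl ≢0

dilate-δ₀ : ∀ w → 1 ≤ w → dilate w (λ μ → χ (μ ≟ 0)) ≗ 1ₛ
dilate-δ₀ w 1≤w zero = dilate-0 w _ 1≤w
dilate-δ₀ w 1≤w (suc t) with w ∣? suc t
... | yes (divides (suc μ) _) = refl
... | no _ = refl

dilate-≈1ₛ : ∀ {N} w q → 1 ≤ w → N < w → q 0 ≡ 1 → dilate w q ≈[ N ] 1ₛ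
dilate-≈1ₛ w q 1≤w _ q₀≡1 zero _ = trans (dilate-0 w q 1≤w) q₀≡1
dilate-≈1ₛ w q 1≤w N<w _ (suc t) t≤N = dilate-∤ w q (λ w∣t → <⇒≱ (≤-<-trans t≤N N<w) (∣⇒≤ w∣t))

when-dilate-≈1ₛ : ∀ {N} {A : Set} (a? : Dec A) w q → 1 ≤ w → N < w → q 0 ≡ 1 → when a? (dilate w q) ≈[ N ] 1ₛ
when-dilate-≈1ₛ (yes _) w q = dilate-≈1ₛ w q
when-dilate-≈1ₛ (no _) _ _ _ _ _ = λ _ _ → refl

dilate-unfold : ∀ w q → 1 ≤ w → dilate w q ≗ q 0 ⊙ 1ₛ ⊕ shift w (dilate w (q ∘ suc))
dilate-unfold w q 1≤w t with w ∣? t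
dilate-unfold w q 1≤w t | yes (divides zero refl) =
  sym (trans (cong₂ _+_ (*-identityʳ (q 0)) (shift-< w _ 0 1≤w)) (+-identityʳ _))
dilate-unfold w q 1≤w t | yes (divides (suc μ) refl) =
  sym (trans (cong (_+ shift w (dilate w (q ∘ suc)) (w + μ * w))
                   (trans (cong (q 0 *_) (1ₛ-positive (≤-trans 1≤w (m≤m+n w (μ * w))))) (*-zeroʳ (q 0))))
    (trans (shift-≥ w _ _ (m≤m+n w (μ * w)))
    (trans (cong (dilate w (q ∘ suc)) (m+n∸m≡n w (μ * w)))
           (dilate-∣ w (q ∘ suc) μ 1≤w refl))))
dilate-unfold w q 1≤w zero | no w∤0 = contradiction (w ∣0) w∤0
dilate-unfold w q 1≤w (suc t) | no w∤t with w ≤? suc t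
... | yes w≤t = sym (trans (cong₂ _+_ (*-zeroʳ (q 0)) (shift-≥ w _ (suc t) w≤t))
                      (dilate-∤ w _ (λ w∣t-w → w∤t (∣m∸n∣n⇒∣m w w≤t w∣t-w ∣-refl))))
... | no w≰t = sym (cong₂ _+_ (*-zeroʳ (q 0)) (shift-< w _ (suc t) (≰⇒> w≰t)))

module _ (d : ℕ) (1≤d : 1 ≤ d) (f : ℕ → Series) where
  private
    F : ℕ → Series
    F x = when (d ∣? x) (f x)

    ∏-between-multiples : ∀ M j → j < d → ∏ F (d * M + j) ≗ ∏ F (d * M)
    ∏-between-multiples M zero _ t = cong (λ k → ∏ F k t) (+-identityʳ (d * M))
    ∏-between-multiples M (suc j) 1+j<d t =
      trans (cong (λ k → ∏ F k t) (+-suc (d * M) j))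
      (trans (⊛-congʳ (∏ F (d * M + j)) (when-no (d ∣? suc (d * M + j)) _ d∤) t)
      (trans (⊛-identityʳ _ t) (∏-between-multiples M j (<⇒≤ 1+j<d) t)))
      where
      d∤ : ¬ d ∣ suc (d * M + j)
      d∤ d∣ = <⇒≱ 1+j<d (∣⇒≤ (∣m+n∣m⇒∣n (subst (d ∣_) (sym (+-suc (d * M) j)) d∣) (m∣m*n M)))

  ∏-multiples : ∀ M → ∏ (λ x → when (d ∣? x) (f x)) (d * M) ≗ ∏ (λ p → f (p * d)) M
  ∏-multiples zero t = cong (λ k → ∏ F k t) (*-zeroʳ d)
  ∏-multiples (suc M) t =
    trans (cong (λ k → ∏ F k t) d[1+M]≡)
    (trans (⊛-congʳ (∏ F (d * M + pred d)) (when-yes (d ∣? suc (d * M + pred d)) _ d∣) t)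
    (⊛-cong (λ t′ → trans (∏-between-multiples M (pred d) pred[d]<d t′) (∏-multiples M t′))
            (λ t′ → cong (λ k → f k t′) (trans (sym d[1+M]≡) (*-comm d (suc M)))) t))
    where
    1+pred[d]≡d : suc (pred d) ≡ d
    1+pred[d]≡d = suc-pred d {{>-nonZero 1≤d}}
    pred[d]<d : pred d < d
    pred[d]<d = subst (pred d <_) 1+pred[d]≡d ≤-refl
    d[1+M]≡ : d * suc M ≡ suc (d * M + pred d)
    d[1+M]≡ = trans (*-suc d M) (trans (cong (_+ d * M) (sym 1+pred[d]≡d)) (cong suc (+-comm (pred d) (d * M))))
    d∣ : d ∣ suc (d * M + pred d)
    d∣ = divides (suc M) (trans (sym d[1+M]≡) (*-comm d (suc M)))

∑< : ℕ → (ℕ → ℕ) → ℕ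
∑< zero h = 0
∑< (suc e) h = ∑< e h + h e

∑<-zero : ∀ e h → (∀ j → j < e → h j ≡ 0) → ∑< e h ≡ 0
∑<-zero zero h _ = refl
∑<-zero (suc e) h h≡0 = cong₂ _+_ (∑<-zero e h (λ j j<e → h≡0 j (m<n⇒m<1+n j<e))) (h≡0 e ≤-refl)

∑<-single : ∀ e h j₀ → j₀ < e → (∀ j → j < e → j ≢ j₀ → h j ≡ 0) → ∑< e h ≡ h j₀
∑<-single (suc e) h j₀ j₀<1+e h≡0 with j₀ ≟ e
... | yes refl = cong (_+ h j₀) (∑<-zero e h (λ j j<e → h≡0 j (m<n⇒m<1+n j<e) (<⇒≢ j<e)))
... | no j₀≢e =
  trans (cong₂ _+_ (∑<-single e h j₀ (≤∧≢⇒< (≤-pred j₀<1+e) j₀≢e) (λ j j<e → h≡0 j (m<n⇒m<1+n j<e)))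
                   (h≡0 e ≤-refl (j₀≢e ∘ sym)))
        (+-identityʳ _)

-- 1/(1 − z^w) and (1 − z^{we})/(1 − z^w)
geometric : ℕ → Series
geometric w = dilate w (λ _ → 1)

geometric< : ℕ → ℕ → Series
geometric< w e = dilate w (λ j → χ (j <? e))

shift-1ₛ : ∀ a t → shift a 1ₛ t ≡ χ (t ≟ a)
shift-1ₛ a t with a ≤? t
... | yes a≤t = trans (shift-≥ a 1ₛ t a≤t) (1ₛ-at (t ∸ a) (t ≟ a) (m+[n∸m]≡n a≤t))
  where
  1ₛ-at : ∀ u (t≟a : Dec (t ≡ a)) → a + u ≡ t → 1ₛ u ≡ χ t≟a
  1ₛ-at zero t≟a a+0≡t = sym (χ-yes t≟a (trans (sym a+0≡t) (+-identityʳ a)))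
  1ₛ-at (suc u) t≟a refl = sym (χ-no t≟a (m+1+n≢m a))
... | no a≰t = trans (shift-< a 1ₛ t (≰⇒> a≰t)) (sym (χ-no (t ≟ a) (λ { refl → a≰t ≤-refl })))

shift-1ₛ-⊛ : ∀ a g → shift a 1ₛ ⊛ g ≗ shift a g
shift-1ₛ-⊛ a g t = trans (⊛-comm (shift a 1ₛ) g t) (trans (⊛-shift a g 1ₛ t) (shift-cong a (⊛-identityʳ g) t))

geometric<-suc : ∀ w e → 1 ≤ w → geometric< w (suc e) ≗ geometric< w e ⊕ shift (w * e) 1ₛ
geometric<-suc w e 1≤w t with w ∣? t
... | yes (divides μ t≡μw) =
  trans (χ-<-suc μ e) (cong (χ (μ <? e) +_) (sym (trans (shift-1ₛ (w * e) t)
    (χ-cong (λ t≡we → *-cancelʳ-≡ μ e w {{>-nonZero 1≤w}} (trans (sym t≡μw) (trans t≡we (*-comm w e))))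
            (λ { refl → trans t≡μw (*-comm μ w) }) (t ≟ w * e) (μ ≟ e)))))
  where
  χ-<-suc : ∀ μ e → χ (μ <? suc e) ≡ χ (μ <? e) + χ (μ ≟ e)
  χ-<-suc μ e with μ <? e
  ... | yes μ<e = trans (χ-yes (μ <? suc e) (m<n⇒m<1+n μ<e)) (cong suc (sym (χ-no (μ ≟ e) (<⇒≢ μ<e))))
  ... | no μ≮e with μ ≟ e
  ...   | yes refl = χ-yes (μ <? suc μ) ≤-refl
  ...   | no μ≢e = χ-no (μ <? suc e) (λ μ<1+e → μ≢e (≤-antisym (≤-pred μ<1+e) (≮⇒≥ μ≮e)))
... | no w∤t = sym (trans (shift-1ₛ (w * e) t) (χ-no (t ≟ w * e) (λ { refl → w∤t (m∣m*n e) })))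

geometric<-⊛ : ∀ w e g → 1 ≤ w → ∀ t → (geometric< w e ⊛ g) t ≡ ∑< e (λ j → shift (w * j) g t)
geometric<-⊛ w zero g 1≤w t = trans (⊛-congˡ g geometric<-0 t) (⊛-zeroˡ g t)
  where
  geometric<-0 : geometric< w 0 ≗ 0ₛ
  geometric<-0 t with w ∣? t
  ... | yes _ = refl
  ... | no _ = refl
geometric<-⊛ w (suc e) g 1≤w t =
  trans (⊛-congˡ g (geometric<-suc w e 1≤w) t)
  (trans (⊛-distribʳ-⊕ (geometric< w e) (shift (w * e) 1ₛ) g t)
         (cong₂ _+_ (geometric<-⊛ w e g 1≤w t) (shift-1ₛ-⊛ (w * e) g t)))

-- Digit splitting and a Glaisher-type identity

digit-unique : ∀ {c e j₁ j₂ a₁ a₂} → 1 ≤ c → 1 ≤ e → j₁ < e → j₂ < e → c ∣ a₁ → c ∣ a₂ →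
               c * j₁ + e * a₁ ≡ c * j₂ + e * a₂ → j₁ ≡ j₂
digit-unique {c} {e} {j₁} {j₂} 1≤c 1≤e j₁<e j₂<e (divides b₁ refl) (divides b₂ refl) eq = begin
  j₁                ≡⟨ m<n⇒m%n≡m j₁<e ⟨
  j₁ % e            ≡⟨ [m+kn]%n≡m%n j₁ b₁ e ⟨
  (j₁ + b₁ * e) % e ≡⟨ %-congˡ quotients≡ ⟩
  (j₂ + b₂ * e) % e ≡⟨ [m+kn]%n≡m%n j₂ b₂ e ⟩
  j₂ % e            ≡⟨ m<n⇒m%n≡m j₂<e ⟩
  j₂                ∎
  where
  open ≡-Reasoning
  instance _ = >-nonZero 1≤e
  factor : ∀ j b → c * j + e * (b * c) ≡ (j + b * e) * c
  factor j b = solve c e j b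
    where solve : ∀ c e j b → c * j + e * (b * c) ≡ (j + b * e) * c
          solve = solve-∀
  quotients≡ : j₁ + b₁ * e ≡ j₂ + b₂ * e
  quotients≡ = *-cancelʳ-≡ _ _ c {{>-nonZero 1≤c}} (trans (sym (factor j₁ b₁)) (trans eq (factor j₂ b₂)))

module _ {A A′ : ℕ → Set} (A? : Decidable A) (A′? : Decidable A′)
         (w c e : ℕ) (1≤w : 1 ≤ w) (1≤c : 1 ≤ c) (1≤e : 1 ≤ e)
         (A′⊆cℕ : ∀ a → A′ a → c ∣ a)
         (A-decompose : ∀ μ → A μ → ∃ λ j → j < e × ∃ λ a → A′ a × μ ≡ c * j + e * a)
         (A-compose : ∀ j a → j < e → A′ a → A (c * j + e * a)) where
  private
    g : Series
    g = dilate (w * e) (χ ∘ A′?)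

    term : ℕ → ℕ → ℕ
    term t j = shift (w * c * j) g t

    expand : ∀ j a → w * c * j + a * (w * e) ≡ (c * j + e * a) * w
    expand j a = solve w c e j a
      where solve : ∀ w c e j a → w * c * j + a * (w * e) ≡ (c * j + e * a) * w
            solve = solve-∀

    term≢0 : ∀ t j → term t j ≢ 0 → ∃ λ a → A′ a × t ≡ (c * j + e * a) * w
    term≢0 t j ≢0 with w * c * j ≤? t
    ... | no ≰ = contradiction (shift-< (w * c * j) g t (≰⇒> ≰)) ≢0
    ... | yes ≤t with dilate-≢0 (w * e) (χ ∘ A′?) (t ∸ w * c * j) (≢0 ∘ trans (shift-≥ (w * c * j) g t ≤t))
    ...   | a , t-wcj≡ , χ≢0 =
      a , χ≢0⇒ (A′? a) χ≢0 , trans (sym (m+[n∸m]≡n ≤t)) (trans (cong (w * c * j +_) t-wcj≡) (expand j a))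

    term-vanishes : ∀ t j → (∀ a → A′ a → t ≢ (c * j + e * a) * w) → term t j ≡ 0
    term-vanishes t j never =
      decidable-stable (term t j ≟ 0) λ ≢0 → let a , A′a , t≡ = term≢0 t j ≢0 in never a A′a t≡

    term-hit : ∀ t j a → A′ a → t ≡ (c * j + e * a) * w → term t j ≡ 1
    term-hit t j a A′a t≡ =
      trans (shift-≥ (w * c * j) g t (subst (w * c * j ≤_) (sym t≡′) (m≤m+n _ _)))
      (trans (cong g (trans (cong (_∸ w * c * j) t≡′) (m+n∸m≡n (w * c * j) _)))
      (trans (dilate-∣ (w * e) _ a (*-mono-≤ 1≤w 1≤e) refl) (χ-yes (A′? a) A′a)))
      where t≡′ = trans t≡ (sym (expand j a))

    cancel-w : ∀ {x y} → x * w ≡ y * w → x ≡ y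
    cancel-w = *-cancelʳ-≡ _ _ w {{>-nonZero 1≤w}}

    coefficient : ∀ t → ∑< e (term t) ≡ dilate w (χ ∘ A?) t
    coefficient t with w ∣? t
    ... | no w∤t = ∑<-zero e (term t) λ j _ → term-vanishes t j λ a _ t≡ → w∤t (divides (c * j + e * a) t≡)
    ... | yes (divides μ t≡μw) with A? μ
    ...   | no ¬Aμ = ∑<-zero e (term t) λ j j<e → term-vanishes t j λ a A′a t≡ →
              ¬Aμ (subst A (cancel-w (trans (sym t≡) t≡μw)) (A-compose j a j<e A′a))
    ...   | yes Aμ with A-decompose μ Aμ
    ...     | j₀ , j₀<e , a₀ , A′a₀ , μ≡ =
      trans (∑<-single e (term t) j₀ j₀<e others) (term-hit t j₀ a₀ A′a₀ (trans t≡μw (cong (_* w) μ≡)))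
      where
      others : ∀ j → j < e → j ≢ j₀ → term t j ≡ 0
      others j j<e j≢j₀ = term-vanishes t j λ a A′a t≡ →
        j≢j₀ (digit-unique 1≤c 1≤e j<e j₀<e (A′⊆cℕ a A′a) (A′⊆cℕ a₀ A′a₀)
               (cancel-w (trans (sym t≡) (trans t≡μw (cong (_* w) μ≡)))))

  dilate-digitSplit : dilate w (χ ∘ A?) ≗ geometric< (w * c) e ⊛ dilate (w * e) (χ ∘ A′?)
  dilate-digitSplit t = sym (trans (geometric<-⊛ (w * c) e g (*-mono-≤ 1≤w 1≤c) t) (coefficient t))

geometric-factor : ∀ x e → 1 ≤ x → 1 ≤ e → geometric x ≗ geometric< x e ⊛ geometric (x * e)
geometric-factor x e 1≤x 1≤e t =
  trans (dilate-digitSplit {A = λ _ → ⊤} {A′ = λ _ → ⊤} (λ _ → yes tt) (λ _ → yes tt)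
           x 1 e 1≤x ≤-refl 1≤e (λ a _ → 1∣ a) decompose (λ _ _ _ _ → tt) t)
        (⊛-congˡ _ (λ t′ → cong (λ W → geometric< W e t′) (*-identityʳ x)) t)
  where
  instance _ = >-nonZero 1≤e
  decompose : ∀ μ → ⊤ → ∃ λ j → j < e × ∃ λ a → ⊤ × μ ≡ 1 * j + e * a
  decompose μ _ = μ % e , m%n<n μ e , μ / e , tt ,
    trans (m≡m%n+[m/n]*n μ e) (cong₂ _+_ (sym (*-identityˡ (μ % e))) (*-comm (μ / e) e))

Band : ℕ → ℕ → ℕ → Set
Band c e x = c ∣ x × ¬ c * e ∣ x

band? : ∀ c e x → Dec (Band c e x)
band? c e x = c ∣? x ×-dec ¬? (c * e ∣? x)

module _ (c e : ℕ) (1≤c : 1 ≤ c) (1≤e : 1 ≤ e) where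
  private
    1≤pc : ∀ p → 1 ≤ p → 1 ≤ p * c
    1≤pc p 1≤p = *-mono-≤ 1≤p 1≤c

    p≤pc : ∀ p → p ≤ p * c
    p≤pc p = subst (_≤ p * c) (*-identityʳ p) (*-monoʳ-≤ p 1≤c)

    N≤kN : ∀ k N → 1 ≤ k → N ≤ k * N
    N≤kN k N 1≤k = subst (_≤ k * N) (*-identityˡ N) (*-monoˡ-≤ N 1≤k)

    pec≡pce : ∀ p → p * e * c ≡ p * c * e
    pec≡pce p = trans (*-assoc p e c) (trans (cong (p *_) (*-comm e c)) (sym (*-assoc p c e)))

    T F U G H : ℕ → Series
    T = ∏ λ p → geometric (p * c)
    F = ∏ λ p → geometric< (p * c) e
    U = ∏ λ p → geometric (p * c * e)
    G = ∏ λ p → when (¬? (e ∣? p)) (geometric (p * c))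
    H = ∏ λ p → when (e ∣? p) (geometric (p * c))

    T≗FU : ∀ M → T M ≗ F M ⊛ U M
    T≗FU M = ≗-trans (∏-cong M λ p 1≤p _ → geometric-factor (p * c) e (1≤pc p 1≤p) 1≤e) (∏-⊛ _ _ M)

    T≗GH : ∀ M → T M ≗ G M ⊛ H M
    T≗GH M = ≗-trans (∏-cong M λ p _ _ → ≗-sym (when-¬⊛when (e ∣? p) (geometric (p * c)))) (∏-⊛ _ _ M)

    H≗U : ∀ M → H (e * M) ≗ U M
    H≗U M = ≗-trans (∏-multiples e 1≤e (λ p → geometric (p * c)) M)
      (∏-cong M λ p _ _ t → cong (λ w → geometric w t) (pec≡pce p))

    ce∣pc⇔e∣p : ∀ p → c * e ∣ p * c ⇔ e ∣ p
    ce∣pc⇔e∣p p = mk⇔ (λ ce∣pc → *-cancelˡ-∣ c {{>-nonZero 1≤c}} (subst (c * e ∣_) (*-comm p c) ce∣pc))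
                      (λ e∣p → subst (c * e ∣_) (*-comm c p) (*-monoʳ-∣ c e∣p))

  -- F ⊛ U = T = G ⊛ H and H (e N) = U, so cancelling U (constant term 1) gives F ≈ G.
  module _ (N : ℕ) where
    private
      T-extend : T N ≈[ N ] T (e * N)
      T-extend = ∏-extend _ N (e * N) (N≤kN e N 1≤e) λ p N<p _ →
        dilate-≈1ₛ (p * c) _ (1≤pc p (<-≤-trans (s≤s z≤n) N<p)) (<-≤-trans N<p (p≤pc p)) refl

      G-extend : G N ≈[ N ] G (e * N)
      G-extend = ∏-extend _ N (e * N) (N≤kN e N 1≤e) λ p N<p _ →
        when-dilate-≈1ₛ (¬? (e ∣? p)) (p * c) _
          (1≤pc p (<-≤-trans (s≤s z≤n) N<p)) (<-≤-trans N<p (p≤pc p)) refl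

      U-unit : U N 0 ≡ 1
      U-unit = ∏-constant _ N λ p 1≤p → dilate-0 (p * c * e) _ (*-mono-≤ (1≤pc p 1≤p) 1≤e)

      F≈G : F N ≈[ N ] G N
      F≈G = ⊛-cancelʳ (F N) (G N) (U N) U-unit
        (≈-trans (≗⇒≈ (≗-sym (T≗FU N)))
        (≈-trans T-extend
        (≈-trans (≗⇒≈ (≗-trans (T≗GH (e * N)) (⊛-congʳ (G (e * N)) (H≗U N))))
                 (⊛-≈ˡ (U N) (≈-sym G-extend)))))

      G≈target : ∏ (λ x → when (band? c e x) (geometric x)) N ≈[ N ] G N
      G≈target = ≈-trans
        (∏-extend _ N (c * N) (N≤kN c N 1≤c) λ x N<x _ →
          when-dilate-≈1ₛ (band? c e x) x _ (<-≤-trans (s≤s z≤n) N<x) N<x refl)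
        (≗⇒≈ (≗-trans (∏-cong (c * N) λ x _ _ → when-× (c ∣? x) (¬? (c * e ∣? x)) (geometric x))
             (≗-trans (∏-multiples c 1≤c (λ x → when (¬? (c * e ∣? x)) (geometric x)) N)
                      (∏-cong N λ p _ _ → let open Equivalence (ce∣pc⇔e∣p p) in
                        when-cong (λ ¬ce∣ e∣p → ¬ce∣ (from e∣p)) (λ ¬e∣ ce∣ → ¬e∣ (to ce∣))
                                  (¬? (c * e ∣? p * c)) (¬? (e ∣? p)) (geometric (p * c))))))

    glaisher : ∏ (λ p → geometric< (p * c) e) N ≈[ N ] ∏ (λ x → when (band? c e x) (geometric x)) N
    glaisher = ≈-trans F≈G (≈-sym G≈target)

-- Counting partitions with prescribed multiplicities

module _ {A : Set} where

  count : {P : Pred A 0ℓ} → Decidable P → List A → ℕ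
  count P? xs = length (filter P? xs)

  count-∷ : {P : Pred A 0ℓ} (P? : Decidable P) → ∀ x xs → count P? (x ∷ xs) ≡ χ (P? x) + count P? xs
  count-∷ P? x xs with P? x
  ... | yes _ = refl
  ... | no _ = refl

  count-++ : {P : Pred A 0ℓ} (P? : Decidable P) → ∀ xs ys → count P? (xs ++ ys) ≡ count P? xs + count P? ys
  count-++ P? xs ys = trans (cong length (filter-++ P? xs ys)) (length-++ (filter P? xs))

  count-map : {P : Pred A 0ℓ} (P? : Decidable P) (h : A → A) → ∀ xs → count P? (map h xs) ≡ count (P? ∘ h) xs
  count-map P? h [] = refl
  count-map P? h (x ∷ xs) =
    trans (count-∷ P? (h x) (map h xs))
    (trans (cong (χ (P? (h x)) +_) (count-map P? h xs)) (sym (count-∷ (P? ∘ h) x xs)))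

  count-cong : {P P′ : Pred A 0ℓ} (P? : Decidable P) (P′? : Decidable P′) → ∀ xs →
               All (λ x → P x ⇔ P′ x) xs → count P? xs ≡ count P′? xs
  count-cong P? P′? [] [] = refl
  count-cong P? P′? (x ∷ xs) (x⇔ ∷ hs) =
    trans (count-∷ P? x xs)
    (trans (cong₂ _+_ (χ-cong to from (P? x) (P′? x)) (count-cong P? P′? xs hs)) (sym (count-∷ P′? x xs)))
    where open Equivalence x⇔

  count-factor : {P P′ : Pred A 0ℓ} {C : Set} (P? : Decidable P) (P′? : Decidable P′) (C? : Dec C) → ∀ xs →
                 All (λ x → P x ⇔ (C × P′ x)) xs → count P? xs ≡ χ C? * count P′? xs
  count-factor P? P′? C? [] [] = sym (*-zeroʳ (χ C?))
  count-factor {P} {P′} {C} P? P′? C? (x ∷ xs) (x⇔ ∷ hs) =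
    trans (count-∷ P? x xs)
    (trans (cong₂ _+_ (χ-factor C? (P? x) (P′? x)) (count-factor P? P′? C? xs hs))
    (trans (sym (*-distribˡ-+ (χ C?) (χ (P′? x)) _)) (cong (χ C? *_) (sym (count-∷ P′? x xs)))))
    where
    open Equivalence x⇔
    χ-factor : (c? : Dec C) (p? : Dec (P x)) (p′? : Dec (P′ x)) → χ p? ≡ χ c? * χ p′?
    χ-factor c? (yes p) p′? = let c , p′ = to p in sym (cong₂ _*_ (χ-yes c? c) (χ-yes p′? p′))
    χ-factor (yes c) (no ¬p) p′? = sym (trans (*-identityˡ _) (χ-no p′? (λ p′ → ¬p (from (c , p′)))))
    χ-factor (no _) (no _) p′? = refl

mult-++ : ∀ p xs ys → mult p (xs ++ ys) ≡ mult p xs + mult p ys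
mult-++ p = count-++ (p ≟_)

mult-replicate : ∀ a j → mult a (replicate j a) ≡ j
mult-replicate a zero = refl
mult-replicate a (suc j) =
  trans (count-∷ (a ≟_) a (replicate j a)) (cong₂ _+_ (χ-yes (a ≟ a) refl) (mult-replicate a j))

mult-replicate-≢ : ∀ p a j → p ≢ a → mult p (replicate j a) ≡ 0
mult-replicate-≢ p a zero _ = refl
mult-replicate-≢ p a (suc j) p≢a =
  trans (count-∷ (p ≟_) a (replicate j a)) (cong₂ _+_ (χ-no (p ≟ a) p≢a) (mult-replicate-≢ p a j p≢a))

mult-> : ∀ p k xs → k < p → All (_≤ k) xs → mult p xs ≡ 0
mult-> p k [] _ [] = refl
mult-> p k (x ∷ xs) k<p (x≤k ∷ xs≤k) =
  trans (count-∷ (p ≟_) x xs) (cong₂ _+_ (χ-no (p ≟ x) λ { refl → <⇒≱ k<p x≤k }) (mult-> p k xs k<p xs≤k))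

module PartitionCount {R : ℕ → ℕ → Set} (R? : ∀ p k → Dec (R p k)) where

  Admissible : List ℕ → Set
  Admissible xs = All (λ p → R p (mult p xs)) xs

  admissible? : Decidable Admissible
  admissible? xs = All.all? (λ p → R? p (mult p xs)) xs

  Allowed : ℕ → ℕ → Set
  Allowed p μ = μ ≡ 0 ⊎ R p μ

  allowed? : ∀ p μ → Dec (Allowed p μ)
  allowed? p μ = (μ ≟ 0) ⊎-dec R? p μ

  multiplicitySeries : ℕ → Series
  multiplicitySeries p = dilate p (χ ∘ allowed? p)

  private
    Π : ℕ → Series
    Π = ∏ multiplicitySeries

    tail : ℕ → ℕ → Series
    tail w j = dilate w (λ μ → χ (allowed? w (j + μ)))

    admissibleAfter : ∀ j k → Decidable (λ xs → Admissible (replicate j k ++ xs))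
    admissibleAfter j k xs = admissible? (replicate j k ++ xs)

    countAfter : ℕ → ℕ → ℕ → ℕ → ℕ
    countAfter f n k j = count (admissibleAfter j k) (partsF f n k)

    partsF-split : ∀ f n k → k ≤ n →
      partsF (suc f) (suc n) (suc k) ≡ partsF (suc f) (suc n) k ++ map (suc k ∷_) (partsF f (n ∸ k) (suc k))
    partsF-split f n k k≤n = begin
      concatMap g (applyUpTo suc (suc n ⊓ suc k))
        ≡⟨ cong (concatMap g ∘ applyUpTo suc) (m≥n⇒m⊓n≡n (s≤s k≤n)) ⟩
      concatMap g (applyUpTo suc (suc k))
        ≡⟨ cong (concatMap g) (applyUpTo-∷ʳ suc k) ⟨
      concatMap g (applyUpTo suc k ++ [ suc k ])
        ≡⟨ concatMap-++ g (applyUpTo suc k) [ suc k ] ⟩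
      concatMap g (applyUpTo suc k) ++ (g (suc k) ++ [])
        ≡⟨ cong₂ _++_ (cong (concatMap g ∘ applyUpTo suc) (sym (m≥n⇒m⊓n≡n (m≤n⇒m≤1+n k≤n))))
                      (++-identityʳ (g (suc k))) ⟩
      concatMap g (applyUpTo suc (suc n ⊓ k)) ++ g (suc k)
        ∎
      where
      open ≡-Reasoning
      g = λ p → map (p ∷_) (partsF f (suc n ∸ p) p)

    partsF-large : ∀ f n k → n < k → partsF (suc f) (suc n) (suc k) ≡ partsF (suc f) (suc n) k
    partsF-large f n k n<k =
      cong (concatMap g ∘ applyUpTo suc) (trans (m≤n⇒m⊓n≡m (s≤s (<⇒≤ n<k))) (sym (m≤n⇒m⊓n≡m n<k)))
      where g = λ p → map (p ∷_) (partsF f (suc n ∸ p) p)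

    partsF-bounded : ∀ f n k → All (All (_≤ k)) (partsF f n k)
    partsF-bounded f zero k = [] ∷ []
    partsF-bounded zero (suc n) k = []
    partsF-bounded (suc f) (suc n) k =
      concat⁺ (map⁺ (applyUpTo⁺₁ suc (suc n ⊓ k) λ {i} i<n⊓k →
        map⁺ (All.map (λ bounded → 1+i≤k i<n⊓k ∷ All.map (λ x≤1+i → ≤-trans x≤1+i (1+i≤k i<n⊓k)) bounded)
                      (partsF-bounded f (suc n ∸ suc i) (suc i)))))
      where 1+i≤k : ∀ {i} → i < suc n ⊓ k → suc i ≤ k
            1+i≤k i< = ≤-trans i< (m⊓n≤n (suc n) k)

  private
    admissible-replicate-++ : ∀ k j xs → All (_≤ k) xs →
      Admissible (replicate j (suc k) ++ xs) ⇔ (Allowed (suc k) j × Admissible xs)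
    admissible-replicate-++ k j xs xs≤k = mk⇔ to from
      where
      a = suc k
      ys = replicate j a ++ xs

      mult-a : mult a ys ≡ j
      mult-a = trans (mult-++ a (replicate j a) xs)
        (trans (cong₂ _+_ (mult-replicate a j) (mult-> a k xs ≤-refl xs≤k)) (+-identityʳ j))

      mult-below : ∀ p → p ≤ k → mult p ys ≡ mult p xs
      mult-below p p≤k = trans (mult-++ p (replicate j a) xs)
        (cong (_+ mult p xs) (mult-replicate-≢ p a j λ { refl → 1+n≰n p≤k }))

      forget : ∀ {zs} → All (_≤ k) zs → All (λ p → R p (mult p ys)) zs → All (λ p → R p (mult p xs)) zs
      forget zs≤k rs = All.zipWith (λ (p≤k , r) → subst (R _) (mult-below _ p≤k) r) (zs≤k , rs)

      remember : ∀ {zs} → All (_≤ k) zs → All (λ p → R p (mult p xs)) zs → All (λ p → R p (mult p ys)) zs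
      remember zs≤k rs = All.zipWith (λ (p≤k , r) → subst (R _) (sym (mult-below _ p≤k)) r) (zs≤k , rs)

      emptyOrHead : ∀ {Q : ℕ → Set} i → All Q (replicate i a) → i ≡ 0 ⊎ Q a
      emptyOrHead zero _ = inj₁ refl
      emptyOrHead (suc i) (q ∷ _) = inj₂ q

      to : Admissible ys → Allowed a j × Admissible xs
      to adm = let adm-a , adm-xs = ++⁻ (replicate j a) adm in
        Sum.map₂ (subst (R a) mult-a) (emptyOrHead j adm-a) , forget xs≤k adm-xs

      from : Allowed a j × Admissible xs → Admissible ys
      from (inj₁ refl , adm) = remember xs≤k adm
      from (inj₂ r , adm) = ++⁺ (replicate⁺ j (subst (R a) (sym mult-a) r)) (remember xs≤k adm)

    replicate-++-∷ : ∀ (a : ℕ) j ys → replicate j a ++ a ∷ ys ≡ replicate (suc j) a ++ ys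
    replicate-++-∷ a zero ys = refl
    replicate-++-∷ a (suc j) ys = cong (a ∷_) (replicate-++-∷ a j ys)

    count-smallerParts : ∀ f n k j →
      count (admissibleAfter j (suc k)) (partsF f n k) ≡ χ (allowed? (suc k) j) * countAfter f n k 0
    count-smallerParts f n k j = count-factor (admissibleAfter j (suc k)) admissible? (allowed? (suc k) j) _
      (All.map (admissible-replicate-++ k j _) (partsF-bounded f n k))

    count-topPart : ∀ f n k j →
      count (admissibleAfter j (suc k)) (map (suc k ∷_) (partsF f n (suc k))) ≡ countAfter f n (suc k) (suc j)
    count-topPart f n k j = trans (count-map (admissibleAfter j (suc k)) (suc k ∷_) (partsF f n (suc k)))
      (count-cong (admissibleAfter j (suc k) ∘ (suc k ∷_)) (admissibleAfter (suc j) (suc k)) (partsF f n (suc k))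
        (All.tabulate λ {ys} _ →
          let eq = replicate-++-∷ (suc k) j ys in mk⇔ (subst Admissible eq) (subst Admissible (sym eq))))

    countAfter-≤ : ∀ f n k j → k ≤ n →
      countAfter (suc f) (suc n) (suc k) j
        ≡ χ (allowed? (suc k) j) * countAfter (suc f) (suc n) k 0 + countAfter f (n ∸ k) (suc k) (suc j)
    countAfter-≤ f n k j k≤n =
      trans (cong (count (admissibleAfter j (suc k))) (partsF-split f n k k≤n))
      (trans (count-++ (admissibleAfter j (suc k)) (partsF (suc f) (suc n) k) _)
             (cong₂ _+_ (count-smallerParts (suc f) (suc n) k j) (count-topPart f (n ∸ k) k j)))

    countAfter-> : ∀ f n k j → n < k →
      countAfter (suc f) (suc n) (suc k) j ≡ χ (allowed? (suc k) j) * countAfter (suc f) (suc n) k 0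
    countAfter-> f n k j n<k =
      trans (cong (count (admissibleAfter j (suc k))) (partsF-large f n k n<k)) (count-smallerParts (suc f) (suc n) k j)

    countAfter-empty : ∀ f k j → countAfter f 0 (suc k) j ≡ χ (allowed? (suc k) j)
    countAfter-empty f k j =
      trans (count-∷ (admissibleAfter j (suc k)) [] [])
      (trans (+-identityʳ _) (χ-cong (proj₁ ∘ to) (λ allowed → from (allowed , [])) _ (allowed? (suc k) j)))
      where open Equivalence (admissible-replicate-++ k j [] [])

    Π-constant : ∀ k → Π k 0 ≡ 1
    Π-constant k = ∏-constant multiplicitySeries k λ p 1≤p → dilate-0 p _ 1≤p

    Π⊛tail-constant : ∀ k j → (Π k ⊛ tail (suc k) j) 0 ≡ χ (allowed? (suc k) j)
    Π⊛tail-constant k j =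
      trans (cong₂ _*_ (Π-constant k) (dilate-0 (suc k) (λ μ → χ (allowed? (suc k) (j + μ))) (s≤s z≤n)))
      (trans (*-identityˡ _) (cong (χ ∘ allowed? (suc k)) (+-identityʳ j)))

    Π⊛tail-unfold : ∀ k j →
      Π k ⊛ tail (suc k) j ≗ χ (allowed? (suc k) j) ⊙ Π k ⊕ shift (suc k) (Π k ⊛ tail (suc k) (suc j))
    Π⊛tail-unfold k j t =
      trans (⊛-congʳ (Π k) (dilate-unfold (suc k) _ (s≤s z≤n)) t)
      (trans (⊛-distribˡ-⊕ (Π k) _ _ t)
      (cong₂ _+_
        (trans (⊛-⊙-comm (χ (allowed? (suc k) (j + 0))) (Π k) 1ₛ t)
               (cong₂ _*_ (cong (χ ∘ allowed? (suc k)) (+-identityʳ j)) (⊛-identityʳ (Π k) t)))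
        (trans (⊛-shift (suc k) (Π k) _ t)
               (shift-cong (suc k) (⊛-congʳ (Π k) (dilate-cong (suc k) λ μ →
                 cong (χ ∘ allowed? (suc k)) (+-suc j μ))) t))))

    mutual
      countAfter≡ : ∀ f n k j → n ≤ f → countAfter f n (suc k) j ≡ (Π k ⊛ tail (suc k) j) n
      countAfter≡ f zero k j _ = trans (countAfter-empty f k j) (sym (Π⊛tail-constant k j))
      countAfter≡ (suc f) (suc n) k j (s≤s n≤f) with k ≤? n
      ... | yes k≤n =
        trans (countAfter-≤ f n k j k≤n)
        (trans (cong₂ _+_ (cong (χ (allowed? (suc k) j) *_) (countAfter≡Π (suc f) (suc n) k (s≤s n≤f)))
                          (trans (countAfter≡ f (n ∸ k) k (suc j) (≤-trans (m∸n≤m n k) n≤f))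
                                 (sym (shift-≥ k _ n k≤n))))
               (sym (Π⊛tail-unfold k j (suc n))))
      ... | no k≰n =
        trans (countAfter-> f n k j (≰⇒> k≰n))
        (trans (cong (χ (allowed? (suc k) j) *_) (countAfter≡Π (suc f) (suc n) k (s≤s n≤f)))
        (trans (sym (+-identityʳ _))
        (trans (cong (χ (allowed? (suc k) j) * Π k (suc n) +_) (sym (shift-< k _ n (≰⇒> k≰n))))
               (sym (Π⊛tail-unfold k j (suc n))))))

      countAfter≡Π : ∀ f n k → n ≤ f → countAfter f n k 0 ≡ Π k n
      countAfter≡Π f zero k _ = sym (Π-constant k)
      countAfter≡Π (suc f) (suc n) zero _ = refl
      countAfter≡Π (suc f) (suc n) (suc k) n≤f = countAfter≡ (suc f) (suc n) k 0 n≤f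

  count-admissible : ∀ n → length (filter admissible? (partitions n)) ≡ ∏ multiplicitySeries n n
  count-admissible n = countAfter≡Π n n n ≤-refl

-- The sets 𝒜 and ℬ

sumF-cong : ∀ {t} (g g′ : Fin t → ℕ) → (∀ i → g i ≡ g′ i) → sumF g ≡ sumF g′
sumF-cong {zero} g g′ e = refl
sumF-cong {suc t} g g′ e = cong₂ _+_ (e zero) (sumF-cong (g ∘ suc) (g′ ∘ suc) (e ∘ suc))

sumF-*ˡ : ∀ {t} k (g : Fin t → ℕ) → sumF (λ i → k * g i) ≡ k * sumF g
sumF-*ˡ {zero} k g = sym (*-zeroʳ k)
sumF-*ˡ {suc t} k g = trans (cong (k * g zero +_) (sumF-*ˡ k (g ∘ suc))) (sym (*-distribˡ-+ k (g zero) _))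

∣sumF : ∀ {t} d (g : Fin t → ℕ) → (∀ i → d ∣ g i) → d ∣ sumF g
∣sumF {zero} d g _ = d ∣0
∣sumF {suc t} d g d∣g = ∣m∣n⇒∣m+n (d∣g zero) (∣sumF d (g ∘ suc) (d∣g ∘ suc))

sumF-zero : ∀ {t} (g : Fin t → ℕ) → (∀ i → g i ≡ 0) → sumF g ≡ 0
sumF-zero {zero} g _ = refl
sumF-zero {suc t} g g≡0 = cong₂ _+_ (g≡0 zero) (sumF-zero (g ∘ suc) (g≡0 ∘ suc))

∈𝒜list⁻ : ∀ l s m r {x} → x ∈ 𝒜list l s m r →
  ∃ λ v → v < snocF m l zero × ∃ λ f → f ∈ tuples s (snocF m l ∘ suc) ×
     x ≡ coeff m r zero * v + sumF (λ i → coeff m r (suc i) * f i)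
∈𝒜list⁻ l s m r x∈ with ∈-map⁻ _ x∈
... | j , j∈ , refl with find (∈-concatMap⁻ _ {xs = upTo (snocF m l zero)} j∈)
...   | v , v∈ , j∈′ with ∈-map⁻ _ j∈′
...     | f , f∈ , refl = v , ∈-upTo⁻ v∈ , f , f∈ , refl

∈𝒜list⁺ : ∀ l s m r {v f} → v < snocF m l zero → f ∈ tuples s (snocF m l ∘ suc) →
  coeff m r zero * v + sumF (λ i → coeff m r (suc i) * f i) ∈ 𝒜list l s m r
∈𝒜list⁺ l s m r v< f∈ = ∈-map⁺ _ (∈-concatMap⁺ _ (lose (∈-upTo⁺ v<) (∈-map⁺ _ f∈)))

zero∈tuples : ∀ t b → (∀ i → 1 ≤ b i) → ∃ λ f → f ∈ tuples t b × (∀ i → f i ≡ 0)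
zero∈tuples zero b _ = _ , here refl , λ ()
zero∈tuples (suc t) b 1≤b with zero∈tuples t (b ∘ suc) (1≤b ∘ suc)
... | f , f∈ , f≡0 =
  _ , ∈-concatMap⁺ _ (lose (∈-upTo⁺ (1≤b zero)) (∈-map⁺ _ f∈)) , λ { zero → refl ; (suc i) → f≡0 i }

DivisorChain : ∀ {s} → (Fin (suc s) → ℕ) → Set
DivisorChain {s} r = ∀ (i : Fin s) → r (inject₁ i) ∣ r (suc i)

head∣ : ∀ s (r : Fin (suc s) → ℕ) → DivisorChain r → ∀ i → r zero ∣ r i
head∣ s r _ zero = ∣-refl
head∣ (suc s) r chain (suc i) = ∣-trans (chain zero) (head∣ s (r ∘ suc) (chain ∘ suc) i)

snocF-positive : ∀ s (m : Fin s → ℕ) l → 1 ≤ l → (∀ i → 1 ≤ m i) → ∀ i → 1 ≤ snocF m l i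
snocF-positive zero m l 1≤l _ zero = 1≤l
snocF-positive (suc s) m l _ 1≤m zero = 1≤m zero
snocF-positive (suc s) m l 1≤l 1≤m (suc i) = snocF-positive s (m ∘ suc) l 1≤l (1≤m ∘ suc) i

coeff-zero : ∀ {s} (m : Fin s → ℕ) r → coeff m r zero ≡ r zero
coeff-zero m r = *-identityˡ (r zero)

coeff-suc : ∀ {s} (m : Fin (suc s) → ℕ) r i → coeff m r (suc i) ≡ m zero * coeff (m ∘ suc) (r ∘ suc) i
coeff-suc m r i = *-assoc (m zero) (prefixProd (m ∘ suc) i) (r (suc i))

head∣coeff-tail : ∀ s (m : Fin (suc s) → ℕ) r → DivisorChain r → ∀ i → r zero ∣ coeff (m ∘ suc) (r ∘ suc) i
head∣coeff-tail s m r chain i = ∣n⇒∣m*n (prefixProd (m ∘ suc) i) (head∣ (suc s) r chain (suc i))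

∣𝒜 : ∀ l s m r d → (∀ i → d ∣ coeff m r i) → ∀ {x} → x ∈ 𝒜list l s m r → d ∣ x
∣𝒜 l s m r d d∣coeff x∈ with ∈𝒜list⁻ l s m r x∈
... | v , _ , f , _ , refl =
  ∣m∣n⇒∣m+n (∣m⇒∣m*n v (d∣coeff zero)) (∣sumF d _ λ i → ∣m⇒∣m*n (f i) (d∣coeff (suc i)))

0∈𝒜 : ∀ l s m r → (∀ i → 1 ≤ snocF m l i) → 0 ∈ 𝒜list l s m r
0∈𝒜 l s m r 1≤snoc with zero∈tuples s (snocF m l ∘ suc) (1≤snoc ∘ suc)
... | f , f∈ , f≡0 = subst (_∈ 𝒜list l s m r) value (∈𝒜list⁺ l s m r (1≤snoc zero) f∈)
  where
  value : coeff m r zero * 0 + sumF (λ i → coeff m r (suc i) * f i) ≡ 0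
  value = cong₂ _+_ (*-zeroʳ (coeff m r zero))
    (sumF-zero _ λ i → trans (cong (coeff m r (suc i) *_) (f≡0 i)) (*-zeroʳ (coeff m r (suc i))))

𝒜-base⁻ : ∀ l m r {μ} → μ ∈ 𝒜list l 0 m r → ∃ λ v → v < l × ∃ λ a → a ≡ 0 × μ ≡ r zero * v + l * a
𝒜-base⁻ l m r μ∈ with ∈𝒜list⁻ l 0 m r μ∈
... | v , v<l , _ , _ , μ≡ = v , v<l , 0 , refl , trans μ≡ (cong₂ _+_ (cong (_* v) (coeff-zero m r)) (sym (*-zeroʳ l)))

𝒜-base⁺ : ∀ l m r {v a} → v < l → a ≡ 0 → r zero * v + l * a ∈ 𝒜list l 0 m r
𝒜-base⁺ l m r {v} v<l refl with zero∈tuples 0 (snocF m l ∘ suc) (λ ())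
... | f , f∈ , _ =
  subst (_∈ 𝒜list l 0 m r) (cong₂ _+_ (cong (_* v) (coeff-zero m r)) (sym (*-zeroʳ l))) (∈𝒜list⁺ l 0 m r v<l f∈)

private
  sumF-coeff-suc : ∀ s (m : Fin (suc s) → ℕ) r (f : Fin (suc s) → ℕ) →
    sumF (λ i → coeff m r (suc i) * f i) ≡ m zero * sumF (λ i → coeff (m ∘ suc) (r ∘ suc) i * f i)
  sumF-coeff-suc s m r f =
    trans (sumF-cong _ _ λ i → trans (cong (_* f i) (coeff-suc m r i)) (*-assoc (m zero) _ (f i)))
          (sumF-*ˡ (m zero) (λ i → coeff (m ∘ suc) (r ∘ suc) i * f i))

𝒜-step⁻ : ∀ l s m r {μ} → μ ∈ 𝒜list l (suc s) m r →
  ∃ λ v → v < m zero × ∃ λ a → a ∈ 𝒜list l s (m ∘ suc) (r ∘ suc) × μ ≡ r zero * v + m zero * a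
𝒜-step⁻ l s m r μ∈ with ∈𝒜list⁻ l (suc s) m r μ∈
... | v , v< , f , f∈ , μ≡ =
  v , v< , _ , ∈-map⁺ _ f∈ , trans μ≡ (cong₂ _+_ (cong (_* v) (coeff-zero m r)) (sumF-coeff-suc s m r f))

𝒜-step⁺ : ∀ l s m r {v a} → v < m zero → a ∈ 𝒜list l s (m ∘ suc) (r ∘ suc) →
          r zero * v + m zero * a ∈ 𝒜list l (suc s) m r
𝒜-step⁺ l s m r {v} v< a∈ with ∈-map⁻ _ a∈
... | f , f∈ , refl =
  subst (_∈ 𝒜list l (suc s) m r) (cong₂ _+_ (cong (_* v) (coeff-zero m r)) (sumF-coeff-suc s m r f))
        (∈𝒜list⁺ l (suc s) m r v< f∈)

dilate-𝒜-base : ∀ l m r w → 1 ≤ w → 1 ≤ l → 1 ≤ r zero →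
  dilate w (χ ∘ 𝒜? l 0 m r) ≗ geometric< (w * r zero) l
dilate-𝒜-base l m r w 1≤w 1≤l 1≤r₀ =
  ≗-trans (dilate-digitSplit (𝒜? l 0 m r) (_≟ 0) w (r zero) l 1≤w 1≤r₀ 1≤l
             (λ { a refl → r zero ∣0 }) (λ _ → 𝒜-base⁻ l m r) (λ _ _ v<l → 𝒜-base⁺ l m r v<l))
  (≗-trans (⊛-congʳ _ (dilate-δ₀ (w * l) (*-mono-≤ 1≤w 1≤l))) (⊛-identityʳ _))

dilate-𝒜-step : ∀ l s m r w → 1 ≤ w → (∀ i → 1 ≤ m i) → 1 ≤ r zero → DivisorChain r →
  dilate w (χ ∘ 𝒜? l (suc s) m r)
    ≗ geometric< (w * r zero) (m zero) ⊛ dilate (w * m zero) (χ ∘ 𝒜? l s (m ∘ suc) (r ∘ suc))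
dilate-𝒜-step l s m r w 1≤w 1≤m 1≤r₀ chain =
  dilate-digitSplit (𝒜? l (suc s) m r) (𝒜? l s (m ∘ suc) (r ∘ suc)) w (r zero) (m zero) 1≤w 1≤r₀ (1≤m zero)
    (λ _ → ∣𝒜 l s (m ∘ suc) (r ∘ suc) (r zero) (head∣coeff-tail s m r chain))
    (λ _ → 𝒜-step⁻ l s m r) (λ _ _ v< → 𝒜-step⁺ l s m r v<)

-- ℬ for the data with every coefficient multiplied by d, without the positivity condition
dℬ : (l s : ℕ) → (Fin s → ℕ) → (Fin (suc s) → ℕ) → ℕ → ℕ → Set
dℬ l s m r d x = ∃ λ i → Band (d * coeff m r i) (snocF m l i) x

dℬ? : ∀ l s m r d x → Dec (dℬ l s m r d x)
dℬ? l s m r d x = any? λ i → band? (d * coeff m r i) (snocF m l i) x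

dℬ-base : ∀ l m r d {x} → dℬ l 0 m r d x ⇔ Band (d * r zero) l x
dℬ-base l m r d {x} = mk⇔ (λ { (zero , b) → subst (λ c → Band c l x) c≡ b })
                          (λ b → zero , subst (λ c → Band c l x) (sym c≡) b)
  where c≡ = cong (d *_) (coeff-zero m r)

module _ (l s : ℕ) (m : Fin (suc s) → ℕ) (r : Fin (suc (suc s)) → ℕ) (d : ℕ) {x : ℕ} where
  private
    c₀≡ : d * coeff m r zero ≡ d * r zero
    c₀≡ = cong (d *_) (coeff-zero m r)

    cₛ≡ : ∀ i → d * coeff m r (suc i) ≡ d * m zero * coeff (m ∘ suc) (r ∘ suc) i
    cₛ≡ i = trans (cong (d *_) (coeff-suc m r i)) (sym (*-assoc d (m zero) _))

  dℬ-step : dℬ l (suc s) m r d x ⇔ (Band (d * r zero) (m zero) x ⊎ dℬ l s (m ∘ suc) (r ∘ suc) (d * m zero) x)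
  dℬ-step = mk⇔
    (λ { (zero , b) → inj₁ (subst (λ c → Band c (m zero) x) c₀≡ b)
       ; (suc i , b) → inj₂ (i , subst (λ c → Band c (snocF (m ∘ suc) l i) x) (cₛ≡ i) b) })
    (λ { (inj₁ b) → zero , subst (λ c → Band c (m zero) x) (sym c₀≡) b
       ; (inj₂ (i , b)) → suc i , subst (λ c → Band c (snocF (m ∘ suc) l i) x) (sym (cₛ≡ i)) b })

  dℬ-step-disjoint : DivisorChain r → Band (d * r zero) (m zero) x → ¬ dℬ l s (m ∘ suc) (r ∘ suc) (d * m zero) x
  dℬ-step-disjoint chain (_ , ¬dr₀m₀∣x) (i , dm₀c∣x , _) =
    ¬dr₀m₀∣x (∣-trans (subst (_∣ d * m zero * r zero) (swap d (m zero) (r zero)) ∣-refl)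
                      (∣-trans (*-monoʳ-∣ (d * m zero) (head∣coeff-tail s m r chain i)) dm₀c∣x))
    where
    swap : ∀ a b c → a * b * c ≡ a * c * b
    swap = solve-∀

𝒜≈ℬ : ∀ s l (m : Fin s → ℕ) (r : Fin (suc s) → ℕ) →
  1 ≤ l → (∀ i → 1 ≤ m i) → (∀ i → 1 ≤ r i) → DivisorChain r → ∀ d → 1 ≤ d → ∀ N →
  ∏ (λ p → dilate (p * d) (χ ∘ 𝒜? l s m r)) N ≈[ N ] ∏ (λ x → when (dℬ? l s m r d x) (geometric x)) N
𝒜≈ℬ zero l m r 1≤l _ 1≤r _ d 1≤d N =
  ≈-trans (≗⇒≈ (∏-cong N λ p 1≤p _ →
            ≗-trans (dilate-𝒜-base l m r (p * d) (*-mono-≤ 1≤p 1≤d) 1≤l (1≤r zero))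
                    (λ t → cong (λ w → geometric< w l t) (*-assoc p d (r zero)))))
  (≈-trans (glaisher (d * r zero) l (*-mono-≤ 1≤d (1≤r zero)) 1≤l N)
           (≗⇒≈ (∏-cong N λ x _ _ →
             when-cong (Equivalence.from (dℬ-base l m r d)) (Equivalence.to (dℬ-base l m r d))
                       (band? (d * r zero) l x) (dℬ? l 0 m r d x) (geometric x))))
𝒜≈ℬ (suc s) l m r 1≤l 1≤m 1≤r chain d 1≤d N =
  ≈-trans (≗⇒≈ (≗-trans (∏-cong N λ p 1≤p _ →
            ≗-trans (dilate-𝒜-step l s m r (p * d) (*-mono-≤ 1≤p 1≤d) 1≤m (1≤r zero) chain)
                    (⊛-cong (λ t → cong (λ w → geometric< w (m zero) t) (*-assoc p d (r zero)))
                            (λ t → cong (λ w → dilate w (χ ∘ 𝒜? l s (m ∘ suc) (r ∘ suc)) t) (*-assoc p d (m zero)))))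
          (∏-⊛ _ _ N)))
  (≈-trans (⊛-≈ (glaisher (d * r zero) (m zero) (*-mono-≤ 1≤d (1≤r zero)) (1≤m zero) N)
                (𝒜≈ℬ s l (m ∘ suc) (r ∘ suc) 1≤l (1≤m ∘ suc) (1≤r ∘ suc) (chain ∘ suc)
                     (d * m zero) (*-mono-≤ 1≤d (1≤m zero)) N))
           (≗⇒≈ (≗-trans (≗-sym (∏-⊛ _ _ N)) (∏-cong N λ x _ _ →
             let open Equivalence (dℬ-step l s m r d {x}) in
             when-⊎ (band? (d * r zero) (m zero) x) (dℬ? l s (m ∘ suc) (r ∘ suc) (d * m zero) x) (dℬ? l (suc s) m r d x)
                    (geometric x) to (from ∘ inj₁) (from ∘ inj₂) (dℬ-step-disjoint l s m r d chain)))))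

module _ (l s : ℕ) (m : Fin s → ℕ) (r : Fin (suc s) → ℕ) where
  private
    module P𝒜 = PartitionCount {λ _ k → 𝒜 l s m r k} (λ _ → 𝒜? l s m r)
    module Qℬ = PartitionCount {λ p _ → ℬ l s m r p} (λ p _ → ℬ? l s m r p)

  multiplicitySeries-𝒜 : (∀ i → 1 ≤ snocF m l i) → ∀ p →
    PartitionCount.multiplicitySeries (λ _ → 𝒜? l s m r) p ≗ dilate p (χ ∘ 𝒜? l s m r)
  multiplicitySeries-𝒜 1≤snoc p = dilate-cong p λ μ →
    χ-cong Sum.[ (λ { refl → 0∈𝒜 l s m r 1≤snoc }) , id ] inj₂ (P𝒜.allowed? p μ) (𝒜? l s m r μ)

  ℬ⇔dℬ₁ : ∀ {x} → 1 ≤ x → ℬ l s m r x ⇔ dℬ l s m r 1 x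
  ℬ⇔dℬ₁ {x} 1≤x = mk⇔ (λ (_ , i , b) → i , subst (λ c → Band c (snocF m l i) x) (sym (*-identityˡ _)) b)
                       (λ (i , b) → 1≤x , i , subst (λ c → Band c (snocF m l i) x) (*-identityˡ _) b)

  multiplicitySeries-ℬ : ∀ p → 1 ≤ p →
    PartitionCount.multiplicitySeries (λ p _ → ℬ? l s m r p) p ≗ when (dℬ? l s m r 1 p) (geometric p)
  multiplicitySeries-ℬ p 1≤p = byMembership (ℬ? l s m r p)
    where
    byMembership : Dec (ℬ l s m r p) → Qℬ.multiplicitySeries p ≗ when (dℬ? l s m r 1 p) (geometric p)
    byMembership (yes b) =
      ≗-trans (dilate-cong p λ μ → χ-yes (Qℬ.allowed? p μ) (inj₂ b))
              (≗-sym (when-yes (dℬ? l s m r 1 p) (geometric p) (Equivalence.to (ℬ⇔dℬ₁ 1≤p) b)))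
    byMembership (no ¬b) =
      ≗-trans (dilate-cong p λ μ → χ-cong Sum.[ id , (λ b → contradiction b ¬b) ] inj₁ (Qℬ.allowed? p μ) (μ ≟ 0))
      (≗-trans (dilate-δ₀ p 1≤p)
               (≗-sym (when-no (dℬ? l s m r 1 p) (geometric p) (¬b ∘ Equivalence.from (ℬ⇔dℬ₁ 1≤p)))))

theorem3p1 : (l s : ℕ) (m : Fin s → ℕ) (r : Fin (suc s) → ℕ) →
    1 ≤ l → 1 ≤ s → (∀ i → 1 ≤ m i) → (∀ i → 1 ≤ r i) →
    (∀ (i : Fin s) → r (inject₁ i) ∣ r (suc i)) →
    ∀ (n : ℕ) → 1 ≤ n →
    P (𝒜 l s m r) (𝒜? l s m r) n ≡ Q (ℬ l s m r) (ℬ? l s m r) n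
theorem3p1 l s m r 1≤l _ 1≤m 1≤r chain n _ = begin
  P (𝒜 l s m r) (𝒜? l s m r) n
    ≡⟨ PartitionCount.count-admissible (λ _ → 𝒜? l s m r) n ⟩
  ∏ (PartitionCount.multiplicitySeries (λ _ → 𝒜? l s m r)) n n
    ≡⟨ ∏-cong n (λ p _ _ → ≗-trans (multiplicitySeries-𝒜 l s m r (snocF-positive s m l 1≤l 1≤m) p)
                                   (λ t → cong (λ w → dilate w (χ ∘ 𝒜? l s m r) t) (sym (*-identityʳ p)))) n ⟩
  ∏ (λ p → dilate (p * 1) (χ ∘ 𝒜? l s m r)) n n
    ≡⟨ 𝒜≈ℬ s l m r 1≤l 1≤m 1≤r chain 1 ≤-refl n n ≤-refl ⟩
  ∏ (λ x → when (dℬ? l s m r 1 x) (geometric x)) n n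
    ≡⟨ ∏-cong n (λ x 1≤x _ → multiplicitySeries-ℬ l s m r x 1≤x) n ⟨
  ∏ (PartitionCount.multiplicitySeries (λ p _ → ℬ? l s m r p)) n n
    ≡⟨ PartitionCount.count-admissible (λ p _ → ℬ? l s m r p) n ⟨
  Q (ℬ l s m r) (ℬ? l s m r) n
    ∎
  where open ≡-Reasoning
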